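{- Let $B$ be a skew-symmetrizable matrix such that every chordless cycle in $\Gamma(B)$ is cyclically oriented, and let $A$ be a positive quasi-Cartan companion of $B$. Then for every matrix index $k$, the matrix $\mu_k(B)$ has a positive quasi-Cartan companion.
   Context: All matrices are square integer matrices. $B$ is skew-symmetrizable if $DB$ is skew-symmetric for some diagonal $D$ with positive diagonal entries. A quasi-Cartan matrix is a matrix $A$ with all diagonal entries $2$ such that $DA$ is symmetric for some such $D$; it is positive if $DA$ is positive definite. A quasi-Cartan companion of $B$ is a quasi-Cartan matrix $A$ with $|A_{ij}|=|B_{ij}|$ for all $i\ne j$. Mutation: $\mu_k(B)=B'$ with $B'_{ij}=-B_{ij}$ if $i=k$ or $j=k$, and $B'_{ij}=B_{ij}+\operatorname{sgn}(B_{ik})[B_{ik}B_{kj}]_+$ otherwise ($[x]_+=\max(x,0)$, $\operatorname{sgn}(0)=0$). $\Gamma(B)$ is the directed graph on the indices with an arrow $i\to j$ whenever $B_{ij}>0$. A chordless cycle is an induced subgraph whose underlying undirected graph is a cycle with vertices labeled by $\mathbb{Z}/p\mathbb{Z}$ ($p\ge3$) and edges exactly $\{i,i+1\}$; it is cyclically oriented if, for a suitable such labeling, all edges are oriented $i\to i+1$.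
   Formalization: The positive diagonal matrices D have rational diagonal entries, and positive definiteness of DA is tested on nonzero rational vectors. -}

module Defs where

open import Data.Nat as ℕ using (ℕ; zero; suc)
open import Data.Nat.DivMod using (_mod_)
open import Data.Integer as ℤ using (ℤ; +_; -[1+_]; 0ℤ; ∣_∣)
open import Data.Rational as ℚ using (ℚ; 0ℚ)
open import Data.Fin using (Fin; toℕ; _≟_)
import Data.Fin as F
open import Data.Product using (Σ; ∃; ∃-syntax; _×_; _,_)
open import Data.Sum using (_⊎_)
open import Relation.Binary.PropositionalEquality using (_≡_; _≢_)
open import Relation.Nullary using (¬_; yes; no)
open import Function.Bundles using (_⇔_)

Matrix : ℕ → Set
Matrix n = Fin n → Fin n → ℤ

ι : ℤ → ℚ
ι z = z ℚ./ 1

Σᶠ : ∀ {n} → (Fin n → ℚ) → ℚ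
Σᶠ {zero}  f = 0ℚ
Σᶠ {suc n} f = f F.zero ℚ.+ Σᶠ (λ i → f (F.suc i))

-- diagonal matrices with positive diagonal entries, given by their diagonal
PositiveDiagonal : ∀ {n} → (Fin n → ℚ) → Set
PositiveDiagonal {n} d = ∀ (i : Fin n) → 0ℚ ℚ.< d i

diagMul : ∀ {n} → (Fin n → ℚ) → Matrix n → Fin n → Fin n → ℚ
diagMul d M i j = d i ℚ.* ι (M i j)

SkewSymmetricℚ : ∀ {n} → (Fin n → Fin n → ℚ) → Set
SkewSymmetricℚ {n} M = ∀ (i j : Fin n) → M i j ≡ ℚ.- (M j i)

Symmetricℚ : ∀ {n} → (Fin n → Fin n → ℚ) → Set
Symmetricℚ {n} M = ∀ (i j : Fin n) → M i j ≡ M j i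

PositiveDefiniteℚ : ∀ {n} → (Fin n → Fin n → ℚ) → Set
PositiveDefiniteℚ {n} M =
  ∀ (x : Fin n → ℚ) → (∃[ i ] x i ≢ 0ℚ) →
    0ℚ ℚ.< Σᶠ (λ i → Σᶠ (λ j → x i ℚ.* M i j ℚ.* x j))

SkewSymmetrizable : ∀ {n} → Matrix n → Set
SkewSymmetrizable B = ∃[ d ] PositiveDiagonal d × SkewSymmetricℚ (diagMul d B)

QuasiCartan : ∀ {n} → Matrix n → Set
QuasiCartan {n} A =
  (∀ (i : Fin n) → A i i ≡ + 2) ×
  (∃[ d ] PositiveDiagonal d × Symmetricℚ (diagMul d A))

PositiveQuasiCartan : ∀ {n} → Matrix n → Set
PositiveQuasiCartan {n} A =
  (∀ (i : Fin n) → A i i ≡ + 2) ×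
  (∃[ d ] PositiveDiagonal d × Symmetricℚ (diagMul d A)
                             × PositiveDefiniteℚ (diagMul d A))

IsCompanion : ∀ {n} → Matrix n → Matrix n → Set
IsCompanion {n} A B = ∀ (i j : Fin n) → i ≢ j → ∣ A i j ∣ ≡ ∣ B i j ∣

PositiveQuasiCartanCompanion : ∀ {n} → Matrix n → Matrix n → Set
PositiveQuasiCartanCompanion A B = PositiveQuasiCartan A × IsCompanion A B

sgn : ℤ → ℤ
sgn (+ zero)    = 0ℤ
sgn (+ (suc _)) = + 1
sgn -[1+ _ ]    = -[1+ 0 ]

[_]₊ : ℤ → ℤ
[ x ]₊ = x ℤ.⊔ 0ℤ

μ : ∀ {n} → Fin n → Matrix n → Matrix n
μ k B i j with i ≟ k | j ≟ k
... | yes _ | _     = ℤ.- B i j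
... | no _  | yes _ = ℤ.- B i j
... | no _  | no _  = B i j ℤ.+ sgn (B i k) ℤ.* [ B i k ℤ.* B k j ]₊

-- Γ(B): arrow i → j iff B_ij > 0
Arrow : ∀ {n} → Matrix n → Fin n → Fin n → Set
Arrow B i j = 0ℤ ℤ.< B i j

Edge : ∀ {n} → Matrix n → Fin n → Fin n → Set
Edge B i j = Arrow B i j ⊎ Arrow B j i

next : ∀ {m} → Fin (suc m) → Fin (suc m)
next {m} i = suc (toℕ i) mod (suc m)

-- cycle labelings: p = m + 3, labeling v : ℤ/pℤ → vertices, injective;
-- the induced subgraph on the image has edges exactly {a, a+1}
IsChordlessCycle : ∀ {n} → Matrix n → (m : ℕ) → (Fin (3 ℕ.+ m) → Fin n) → Set
IsChordlessCycle B m v =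
  (∀ a b → v a ≡ v b → a ≡ b) ×
  (∀ a b → Edge B (v a) (v b) ⇔ (b ≡ next a ⊎ a ≡ next b))

SameVertexSet : ∀ {n p} → (Fin p → Fin n) → (Fin p → Fin n) → Set
SameVertexSet v w = (∀ a → ∃[ b ] v a ≡ w b) × (∀ b → ∃[ a ] w b ≡ v a)

-- cyclically oriented: some labeling of the same induced cycle has all
-- edges oriented a → a+1
CyclicallyOriented : ∀ {n} → Matrix n → (m : ℕ) → (Fin (3 ℕ.+ m) → Fin n) → Set
CyclicallyOriented B m v =
  ∃[ w ] SameVertexSet v w × IsChordlessCycle B m w
       × (∀ a → Arrow B (w a) (w (next a)))

AllChordlessCyclesCyclicallyOriented : ∀ {n} → Matrix n → Set
AllChordlessCyclesCyclicallyOriented B =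
  ∀ m v → IsChordlessCycle B m v → CyclicallyOriented B m v

module Submission where

-- Let S = D A be the symmetrized form of A, the Gram matrix of a basis α₁ … αₙ of a Euclidean
-- space.  Replacing αₚ by its reflection sₖ αₚ = αₚ − Aₖₚ αₖ for every p with an arrow p → k
-- gives another basis (k itself is not moved); its Gram matrix is D A′ for the integer matrix
-- A′ with diagonal 2 that agrees with A except that A′ₚq = Aₚq − Aₚₖ Aₖq whenever exactly one
-- of p, q points to k.  So A′ is again a positive quasi-Cartan matrix, and it remains to
-- compare |A′ₚq| with |μₖ(B)ₚq| = |Bₚq + sgn(Bₚₖ) [Bₚₖ Bₖq]₊|.  Two sign facts make the
-- moduli agree: positivity forces Aₚq · Aₚₖ Aₖq ≥ 0 for distinct p, k, q (otherwise the 3 × 3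
-- principal minor of S on p, k, q would be ≤ 0), and since every triangle in Γ(B) is cyclically
-- oriented, a path p → k → q forces Bₚq ≤ 0, i.e. the mutation correction never has the sign
-- of Bₚq.  Both sides then equal ||Bₚq| − |Bₚₖ Bₖq||.

open import Data.Nat as ℕ using (ℕ; zero; suc)
open import Data.Fin using (Fin; zero; suc; _≟_)
open import Data.Fin.Patterns using (0F; 1F; 2F)
open import Data.Fin.Properties using (¬∀⟶∃¬)
open import Data.Bool using (Bool; true; false; if_then_else_; _xor_)
open import Data.Integer as ℤ using (ℤ; +0; +[1+_]; -[1+_]; 0ℤ; 1ℤ; -1ℤ; ∣_∣)
import Data.Integer.Properties as ℤₚ
import Data.Integer.Tactic.RingSolver as ℤ-Solver
open import Data.Rational as ℚ using (ℚ; 0ℚ; 1ℚ; mkℚ; _+_; _*_; _-_; -_; _<_; _≤_)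
import Data.Rational.Properties as ℚₚ
open import Data.Rational.Solver using (module +-*-Solver)
open +-*-Solver using (solve; _:+_; _:*_; _:-_; :-_; con; _:=_)
import Data.Nat.Coprimality as Coprime
open import Data.Product using (∃-syntax; _×_; _,_; proj₁; proj₂)
open import Data.Sum using (_⊎_; inj₁; inj₂)
open import Data.Empty using (⊥; ⊥-elim)
open import Function using (_∘_; _⇔_; mk⇔)
open import Relation.Nullary using (Dec; does; yes; no; ¬_)
open import Relation.Binary.PropositionalEquality
open import Algebra.Bundles using (CommutativeRing)
open import Algebra.Properties.Semiring.Sum (CommutativeRing.semiring ℚₚ.+-*-commutativeRing)
  using (sum; sum-cong-≗; sum-replicate-zero; ∑-distrib-+; *-distribˡ-sum)
open import Defs

open ≡-Reasoning

-- Finite sums and quadratic forms over ℚ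

Σᶠ≡sum : ∀ {n} (f : Fin n → ℚ) → Σᶠ f ≡ sum f
Σᶠ≡sum {zero}  f = refl
Σᶠ≡sum {suc n} f = cong (f zero +_) (Σᶠ≡sum (f ∘ suc))

sum-zero : ∀ {n} (f : Fin n → ℚ) → (∀ i → f i ≡ 0ℚ) → sum f ≡ 0ℚ
sum-zero {n} f f≡0 = trans (sum-cong-≗ f≡0) (sum-replicate-zero n)

sum-lincomb₃ : ∀ {n} (u v w : ℚ) (f g h : Fin n → ℚ) →
  sum (λ i → u * f i + v * g i + w * h i) ≡ u * sum f + v * sum g + w * sum h
sum-lincomb₃ u v w f g h = begin
  sum (λ i → u * f i + v * g i + w * h i)
    ≡⟨ ∑-distrib-+ (λ i → u * f i + v * g i) (λ i → w * h i) ⟩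
  sum (λ i → u * f i + v * g i) + sum (λ i → w * h i)
    ≡⟨ cong (_+ sum (λ i → w * h i)) (∑-distrib-+ (λ i → u * f i) (λ i → v * g i)) ⟩
  sum (λ i → u * f i) + sum (λ i → v * g i) + sum (λ i → w * h i)
    ≡⟨ sym (cong₂ _+_ (cong₂ _+_ (*-distribˡ-sum u f) (*-distribˡ-sum v g)) (*-distribˡ-sum w h)) ⟩
  u * sum f + v * sum g + w * sum h ∎

sum-expand : ∀ {n} {f f₀ a b c : Fin n → ℚ} (u v w : ℚ) →
  (∀ i → f i ≡ f₀ i + (u * a i + v * b i + w * c i)) →
  sum f ≡ sum f₀ + (u * sum a + v * sum b + w * sum c)
sum-expand {f₀ = f₀} {a} {b} {c} u v w f≗ = begin
  _ ≡⟨ sum-cong-≗ f≗ ⟩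
  _ ≡⟨ ∑-distrib-+ f₀ (λ i → u * a i + v * b i + w * c i) ⟩
  _ ≡⟨ cong (sum f₀ +_) (sum-lincomb₃ u v w a b c) ⟩
  _ ∎

basis : ∀ {n} → Fin n → Fin n → ℚ
basis k i = if does (i ≟ k) then 1ℚ else 0ℚ

basis-diag : ∀ {n} (k : Fin n) → basis k k ≡ 1ℚ
basis-diag k with k ≟ k
... | yes _   = refl
... | no k≢k = ⊥-elim (k≢k refl)

basis-off : ∀ {n} {k i : Fin n} → i ≢ k → basis k i ≡ 0ℚ
basis-off {k = k} {i} i≢k with i ≟ k
... | yes i≡k = ⊥-elim (i≢k i≡k)
... | no _    = refl

sum-basis : ∀ {n} (k : Fin n) (f : Fin n → ℚ) → sum (λ i → basis k i * f i) ≡ f k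
sum-basis zero f = trans
  (cong₂ _+_ (ℚₚ.*-identityˡ (f zero)) (sum-zero _ (λ i → ℚₚ.*-zeroˡ (f (suc i)))))
  (ℚₚ.+-identityʳ (f zero))
sum-basis (suc k) f = trans
  (cong₂ _+_ (ℚₚ.*-zeroˡ (f zero)) (sum-basis k (f ∘ suc)))
  (ℚₚ.+-identityˡ (f (suc k)))

quadForm : ∀ {n} → (Fin n → Fin n → ℚ) → (Fin n → ℚ) → ℚ
quadForm M x = sum λ i → sum λ j → x i * M i j * x j

Σᶠ-quadForm : ∀ {n} (M : Fin n → Fin n → ℚ) (x : Fin n → ℚ) →
  Σᶠ (λ i → Σᶠ (λ j → x i * M i j * x j)) ≡ quadForm M x
Σᶠ-quadForm M x = trans (Σᶠ≡sum (λ i → Σᶠ (λ j → x i * M i j * x j)))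
                         (sum-cong-≗ (λ i → Σᶠ≡sum (λ j → x i * M i j * x j)))

positiveDefinite⇒ : ∀ {n} {M : Fin n → Fin n → ℚ} → PositiveDefiniteℚ M →
  ∀ x → ∃[ i ] x i ≢ 0ℚ → 0ℚ < quadForm M x
positiveDefinite⇒ {M = M} pd x x≢0 = subst (0ℚ <_) (Σᶠ-quadForm M x) (pd x x≢0)

positiveDefinite⇐ : ∀ {n} {M : Fin n → Fin n → ℚ} →
  (∀ x → ∃[ i ] x i ≢ 0ℚ → 0ℚ < quadForm M x) → PositiveDefiniteℚ M
positiveDefinite⇐ {M = M} pd x x≢0 = subst (0ℚ <_) (sym (Σᶠ-quadForm M x)) (pd x x≢0)

positiveDefinite-cong : ∀ {n} {M N : Fin n → Fin n → ℚ} → (∀ i j → M i j ≡ N i j) →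
  PositiveDefiniteℚ M → PositiveDefiniteℚ N
positiveDefinite-cong M≡N pd = positiveDefinite⇐ λ x x≢0 →
  subst (0ℚ <_) (sum-cong-≗ λ i → sum-cong-≗ λ j → cong (λ t → x i * t * x j) (M≡N i j))
        (positiveDefinite⇒ pd x x≢0)

quadForm-basis : ∀ {n} (M : Fin n → Fin n → ℚ) (k : Fin n) → quadForm M (basis k) ≡ M k k
quadForm-basis M k = begin
  quadForm M (basis k)
    ≡⟨ sum-cong-≗ (λ i → trans (sum-cong-≗ (λ j → ℚₚ.*-comm (basis k i * M i j) (basis k j)))
                                (sum-basis k (λ j → basis k i * M i j))) ⟩
  sum (λ i → basis k i * M i k)
    ≡⟨ sum-basis k (λ i → M i k) ⟩
  M k k ∎

span₃ : ∀ {n} → Fin n → Fin n → Fin n → ℚ → ℚ → ℚ → Fin n → ℚ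
span₃ a b c u v w i = u * basis a i + v * basis b i + w * basis c i

span₃-at : ∀ {n} {a b c : Fin n} (u v w : ℚ) → a ≢ b → a ≢ c → span₃ a b c u v w a ≡ u
span₃-at {a = a} {b} {c} u v w a≢b a≢c = begin
  u * basis a a + v * basis b a + w * basis c a
    ≡⟨ cong₂ _+_ (cong₂ _+_ (cong (u *_) (basis-diag a)) (cong (v *_) (basis-off a≢b)))
                 (cong (w *_) (basis-off a≢c)) ⟩
  u * 1ℚ + v * 0ℚ + w * 0ℚ
    ≡⟨ solve 3 (λ u v w → u :* con 1ℚ :+ v :* con 0ℚ :+ w :* con 0ℚ := u) refl u v w ⟩
  u ∎

sum-span₃ : ∀ {n} (a b c : Fin n) (u v w : ℚ) (f : Fin n → ℚ) →
  sum (λ i → span₃ a b c u v w i * f i) ≡ u * f a + v * f b + w * f c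
sum-span₃ a b c u v w f = begin
  sum (λ i → span₃ a b c u v w i * f i)
    ≡⟨ sum-cong-≗ (λ i → distrib u v w (basis a i) (basis b i) (basis c i) (f i)) ⟩
  sum (λ i → u * (basis a i * f i) + v * (basis b i * f i) + w * (basis c i * f i))
    ≡⟨ sum-lincomb₃ u v w (λ i → basis a i * f i) (λ i → basis b i * f i) (λ i → basis c i * f i) ⟩
  u * sum (λ i → basis a i * f i) + v * sum (λ i → basis b i * f i) + w * sum (λ i → basis c i * f i)
    ≡⟨ cong₂ _+_ (cong₂ _+_ (cong (u *_) (sum-basis a f)) (cong (v *_) (sum-basis b f)))
                 (cong (w *_) (sum-basis c f)) ⟩
  u * f a + v * f b + w * f c ∎
  where
  distrib : ∀ u v w x y z t → (u * x + v * y + w * z) * t ≡ u * (x * t) + v * (y * t) + w * (z * t)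
  distrib = solve 7 (λ u v w x y z t →
    (u :* x :+ v :* y :+ w :* z) :* t := u :* (x :* t) :+ v :* (y :* t) :+ w :* (z :* t)) refl

quadForm-span₃ : ∀ {n} (M : Fin n → Fin n → ℚ) (a b c : Fin n) (u v w : ℚ) →
  quadForm M (span₃ a b c u v w) ≡
    u * (M a a * u + M a b * v + M a c * w) +
    v * (M b a * u + M b b * v + M b c * w) +
    w * (M c a * u + M c b * v + M c c * w)
quadForm-span₃ M a b c u v w = begin
  quadForm M x
    ≡⟨ sum-cong-≗ (λ i → trans (sum-cong-≗ (λ j → ℚₚ.*-comm (x i * M i j) (x j)))
                                (sum-span₃ a b c u v w (λ j → x i * M i j))) ⟩
  sum (λ i → u * (x i * M i a) + v * (x i * M i b) + w * (x i * M i c))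
    ≡⟨ sum-cong-≗ (λ i → factor u v w (x i) (M i a) (M i b) (M i c)) ⟩
  sum (λ i → x i * (M i a * u + M i b * v + M i c * w))
    ≡⟨ sum-span₃ a b c u v w (λ i → M i a * u + M i b * v + M i c * w) ⟩
  u * (M a a * u + M a b * v + M a c * w) +
  v * (M b a * u + M b b * v + M b c * w) +
  w * (M c a * u + M c b * v + M c c * w) ∎
  where
  x = span₃ a b c u v w
  factor : ∀ u v w t p q r → u * (t * p) + v * (t * q) + w * (t * r) ≡ t * (p * u + q * v + r * w)
  factor = solve 7 (λ u v w t p q r →
    u :* (t :* p) :+ v :* (t :* q) :+ w :* (t :* r) := t :* (p :* u :+ q :* v :+ r :* w)) refl

-- Principal minors of positive definite matrices

positive-factor : ∀ {p q} → 0ℚ < p → 0ℚ < p * q → 0ℚ < q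
positive-factor {p} {q} 0<p 0<pq =
  ℚₚ.*-cancelˡ-<-nonNeg p {{ℚ.nonNegative (ℚₚ.<⇒≤ 0<p)}} (subst (_< p * q) (sym (ℚₚ.*-zeroʳ p)) 0<pq)

det₃ : ∀ {n} → (Fin n → Fin n → ℚ) → Fin n → Fin n → Fin n → ℚ
det₃ M a b c = M a a * M b b * M c c + M a b * M b c * M c a + M a c * M b a * M c b
             - M a a * M b c * M c b - M b b * M a c * M c a - M c c * M a b * M b a

module _ {n} {M : Fin n → Fin n → ℚ} (pd : PositiveDefiniteℚ M) where

  positiveDefinite-diagonal : ∀ k → 0ℚ < M k k
  positiveDefinite-diagonal k =
    subst (0ℚ <_) (quadForm-basis M k)
      (positiveDefinite⇒ pd (basis k) (k , λ eₖₖ≡0 → 1≢0 (trans (sym (basis-diag k)) eₖₖ≡0)))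
    where
    1≢0 : 1ℚ ≢ 0ℚ
    1≢0 ()

  -- Both test vectors are adjugate columns: on the block {b, c}, M y is (M b b M c c − M b c M c b)
  -- times basis b, and on the block {a, b, c}, M x is det₃ M a b c times basis a.

  positiveDefinite-minor₂ : ∀ {b c} → b ≢ c → 0ℚ < M b b * M c c - M b c * M c b
  positiveDefinite-minor₂ {b} {c} b≢c =
    positive-factor (positiveDefinite-diagonal c) (subst (0ℚ <_) Qy≡ (positiveDefinite⇒ pd y (b , y≢0)))
    where
    y = span₃ b c c (M c c) (- M c b) 0ℚ
    y≢0 : y b ≢ 0ℚ
    y≢0 yb≡0 = ℚₚ.<⇒≢ (positiveDefinite-diagonal c) (sym (trans (sym (span₃-at (M c c) (- M c b) 0ℚ b≢c b≢c)) yb≡0))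
    identity : ∀ mbb mbc mcb mcc →
      mcc * (mbb * mcc + mbc * (- mcb) + mbc * 0ℚ) + (- mcb) * (mcb * mcc + mcc * (- mcb) + mcc * 0ℚ)
        + 0ℚ * (mcb * mcc + mcc * (- mcb) + mcc * 0ℚ)
      ≡ mcc * (mbb * mcc - mbc * mcb)
    identity = solve 4 (λ mbb mbc mcb mcc →
      mcc :* (mbb :* mcc :+ mbc :* (:- mcb) :+ mbc :* con 0ℚ)
        :+ (:- mcb) :* (mcb :* mcc :+ mcc :* (:- mcb) :+ mcc :* con 0ℚ)
        :+ con 0ℚ :* (mcb :* mcc :+ mcc :* (:- mcb) :+ mcc :* con 0ℚ)
      := mcc :* (mbb :* mcc :- mbc :* mcb)) refl
    Qy≡ : quadForm M y ≡ M c c * (M b b * M c c - M b c * M c b)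
    Qy≡ = trans (quadForm-span₃ M b c c (M c c) (- M c b) 0ℚ) (identity (M b b) (M b c) (M c b) (M c c))

  positiveDefinite-det₃ : ∀ {a b c} → a ≢ b → a ≢ c → b ≢ c → 0ℚ < det₃ M a b c
  positiveDefinite-det₃ {a} {b} {c} a≢b a≢c b≢c =
    positive-factor (positiveDefinite-minor₂ b≢c) (subst (0ℚ <_) Qx≡ (positiveDefinite⇒ pd x (a , x≢0)))
    where
    u = M b b * M c c - M b c * M c b
    v = M b c * M c a - M b a * M c c
    w = M b a * M c b - M b b * M c a
    x = span₃ a b c u v w
    x≢0 : x a ≢ 0ℚ
    x≢0 xa≡0 = ℚₚ.<⇒≢ (positiveDefinite-minor₂ b≢c) (sym (trans (sym (span₃-at u v w a≢b a≢c)) xa≡0))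
    adjugate : ∀ maa mab mac mba mbb mbc mca mcb mcc →
      let u = mbb * mcc - mbc * mcb
          v = mbc * mca - mba * mcc
          w = mba * mcb - mbb * mca
      in u * (maa * u + mab * v + mac * w) + v * (mba * u + mbb * v + mbc * w) + w * (mca * u + mcb * v + mcc * w)
         ≡ u * (maa * mbb * mcc + mab * mbc * mca + mac * mba * mcb
                - maa * mbc * mcb - mbb * mac * mca - mcc * mab * mba)
    adjugate = solve 9 (λ maa mab mac mba mbb mbc mca mcb mcc →
      let u = mbb :* mcc :- mbc :* mcb
          v = mbc :* mca :- mba :* mcc
          w = mba :* mcb :- mbb :* mca
      in u :* (maa :* u :+ mab :* v :+ mac :* w) :+ v :* (mba :* u :+ mbb :* v :+ mbc :* w)
           :+ w :* (mca :* u :+ mcb :* v :+ mcc :* w)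
         := u :* (maa :* mbb :* mcc :+ mab :* mbc :* mca :+ mac :* mba :* mcb
                  :- maa :* mbc :* mcb :- mbb :* mac :* mca :- mcc :* mab :* mba)) refl
    Qx≡ : quadForm M x ≡ u * det₃ M a b c
    Qx≡ = trans (quadForm-span₃ M a b c u v w)
                (adjugate (M a a) (M a b) (M a c) (M b a) (M b b) (M b c) (M c a) (M c b) (M c c))

-- Transvections

-- transvected is the Gram matrix of M in the vectors eₚ − gₚ eₖ, and shifted y is the vector
-- with coordinates y in that family; when gₖ = 0 the family is a basis.
module Transvection {n} (M : Fin n → Fin n → ℚ) (k : Fin n) (g : Fin n → ℚ) where

  transvected : Fin n → Fin n → ℚ
  transvected p q = M p q - g p * M k q - g q * M p k + g p * g q * M k k

  shifted : (Fin n → ℚ) → Fin n → ℚ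
  shifted y i = y i + (- sum (λ j → g j * y j)) * basis k i

  transvected-symmetric : Symmetricℚ M → Symmetricℚ transvected
  transvected-symmetric symmetric p q = begin
    M p q - g p * M k q - g q * M p k + g p * g q * M k k
      ≡⟨ cong₂ (λ s t → s - g p * t - g q * M p k + g p * g q * M k k) (symmetric p q) (symmetric k q) ⟩
    M q p - g p * M q k - g q * M p k + g p * g q * M k k
      ≡⟨ cong (λ t → M q p - g p * M q k - g q * t + g p * g q * M k k) (symmetric p k) ⟩
    M q p - g p * M q k - g q * M k p + g p * g q * M k k
      ≡⟨ swap (M q p) (g p) (g q) (M q k) (M k p) (M k k) ⟩
    M q p - g q * M k p - g p * M q k + g q * g p * M k k ∎
    where
    swap : ∀ mqp gp gq mqk mkp mkk →
      mqp - gp * mqk - gq * mkp + gp * gq * mkk ≡ mqp - gq * mkp - gp * mqk + gq * gp * mkk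
    swap = solve 6 (λ mqp gp gq mqk mkp mkk →
      mqp :- gp :* mqk :- gq :* mkp :+ gp :* gq :* mkk := mqp :- gq :* mkp :- gp :* mqk :+ gq :* gp :* mkk) refl

  module _ (y : Fin n → ℚ) where
    private
      G  = sum λ j → g j * y j
      Rₖ = sum λ j → M k j * y j
      Cₖ = sum λ i → y i * M i k
      F : Fin n → ℚ
      F i = sum λ j → y i * M i j * y j

    quadForm-shift : ∀ c → quadForm M (λ i → y i + c * basis k i)
                         ≡ quadForm M y + (c * Cₖ + c * Rₖ + (c * c) * M k k)
    quadForm-shift c = begin
      quadForm M (λ i → y i + c * basis k i)
        ≡⟨ sum-expand c c (c * c) (λ i → trans (inner i) (regroup c (y i) (basis k i) (M i k) (R i) (F i))) ⟩
      quadForm M y + (c * Cₖ + c * sum (λ i → basis k i * R i) + (c * c) * sum (λ i → basis k i * M i k))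
        ≡⟨ cong₂ (λ s t → quadForm M y + (c * Cₖ + c * s + (c * c) * t))
                 (sum-basis k R) (sum-basis k (λ i → M i k)) ⟩
      quadForm M y + (c * Cₖ + c * Rₖ + (c * c) * M k k) ∎
      where
      R : Fin n → ℚ
      R i = sum λ j → M i j * y j
      expand : ∀ c yi yj eki ekj mij →
        (yi + c * eki) * mij * (yj + c * ekj)
          ≡ yi * mij * yj + ((c * yi) * (ekj * mij) + (c * eki) * (mij * yj) + (c * c * eki) * (ekj * mij))
      expand = solve 6 (λ c yi yj eki ekj mij →
        (yi :+ c :* eki) :* mij :* (yj :+ c :* ekj)
          := yi :* mij :* yj :+ ((c :* yi) :* (ekj :* mij) :+ (c :* eki) :* (mij :* yj)
                                 :+ (c :* c :* eki) :* (ekj :* mij))) refl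
      regroup : ∀ c yi eki mik ri fi →
        fi + ((c * yi) * mik + (c * eki) * ri + (c * c * eki) * mik)
          ≡ fi + (c * (yi * mik) + c * (eki * ri) + (c * c) * (eki * mik))
      regroup = solve 6 (λ c yi eki mik ri fi →
        fi :+ ((c :* yi) :* mik :+ (c :* eki) :* ri :+ (c :* c :* eki) :* mik)
          := fi :+ (c :* (yi :* mik) :+ c :* (eki :* ri) :+ (c :* c) :* (eki :* mik))) refl
      inner : ∀ i → sum (λ j → (y i + c * basis k i) * M i j * (y j + c * basis k j))
                  ≡ F i + ((c * y i) * M i k + (c * basis k i) * R i + (c * c * basis k i) * M i k)
      inner i = begin
        _ ≡⟨ sum-expand (c * y i) (c * basis k i) (c * c * basis k i)
                        (λ j → expand c (y i) (y j) (basis k i) (basis k j) (M i j)) ⟩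
        _ ≡⟨ cong₂ (λ s t → F i + ((c * y i) * s + (c * basis k i) * R i + (c * c * basis k i) * t))
                   (sum-basis k (M i)) (sum-basis k (M i)) ⟩
        _ ∎

    quadForm-transvected-expanded :
      quadForm transvected y ≡ quadForm M y + ((- Rₖ) * G + (- G) * Cₖ + (G * M k k) * G)
    quadForm-transvected-expanded =
      sum-expand (- Rₖ) (- G) (G * M k k) (λ i → trans (inner i) (regroup (F i) (g i) (y i) (M i k) Rₖ G (M k k)))
      where
      expand : ∀ yi yj mij gi gj mkj mik mkk →
        yi * (mij - gi * mkj - gj * mik + gi * gj * mkk) * yj
          ≡ yi * mij * yj + ((- (gi * yi)) * (mkj * yj) + (- (yi * mik)) * (gj * yj) + (gi * yi * mkk) * (gj * yj))
      expand = solve 8 (λ yi yj mij gi gj mkj mik mkk →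
        yi :* (mij :- gi :* mkj :- gj :* mik :+ gi :* gj :* mkk) :* yj
          := yi :* mij :* yj :+ ((:- (gi :* yi)) :* (mkj :* yj) :+ (:- (yi :* mik)) :* (gj :* yj)
                                 :+ (gi :* yi :* mkk) :* (gj :* yj))) refl
      regroup : ∀ fi gi yi mik r G mkk →
        fi + ((- (gi * yi)) * r + (- (yi * mik)) * G + (gi * yi * mkk) * G)
          ≡ fi + ((- r) * (gi * yi) + (- G) * (yi * mik) + (G * mkk) * (gi * yi))
      regroup = solve 7 (λ fi gi yi mik r G mkk →
        fi :+ ((:- (gi :* yi)) :* r :+ (:- (yi :* mik)) :* G :+ (gi :* yi :* mkk) :* G)
          := fi :+ ((:- r) :* (gi :* yi) :+ (:- G) :* (yi :* mik) :+ (G :* mkk) :* (gi :* yi))) refl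
      inner : ∀ i → sum (λ j → y i * transvected i j * y j)
                  ≡ F i + ((- (g i * y i)) * Rₖ + (- (y i * M i k)) * G + (g i * y i * M k k) * G)
      inner i = sum-expand (- (g i * y i)) (- (y i * M i k)) (g i * y i * M k k)
        (λ j → expand (y i) (y j) (M i j) (g i) (g j) (M k j) (M i k) (M k k))

    quadForm-transvected : quadForm transvected y ≡ quadForm M (shifted y)
    quadForm-transvected = begin
      quadForm transvected y
        ≡⟨ quadForm-transvected-expanded ⟩
      quadForm M y + ((- Rₖ) * G + (- G) * Cₖ + (G * M k k) * G)
        ≡⟨ regroup (quadForm M y) Rₖ G Cₖ (M k k) ⟩
      quadForm M y + ((- G) * Cₖ + (- G) * Rₖ + ((- G) * (- G)) * M k k)
        ≡⟨ sym (quadForm-shift (- G)) ⟩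
      quadForm M (shifted y) ∎
      where
      regroup : ∀ q r G c mkk →
        q + ((- r) * G + (- G) * c + (G * mkk) * G) ≡ q + ((- G) * c + (- G) * r + ((- G) * (- G)) * mkk)
      regroup = solve 5 (λ q r G c mkk →
        q :+ ((:- r) :* G :+ (:- G) :* c :+ (G :* mkk) :* G)
          := q :+ ((:- G) :* c :+ (:- G) :* r :+ ((:- G) :* (:- G)) :* mkk)) refl

  module _ (gₖ≡0 : g k ≡ 0ℚ) where

    shifted-injective : ∀ y → (∀ i → shifted y i ≡ 0ℚ) → ∀ i → y i ≡ 0ℚ
    shifted-injective y shifted≡0 = y≡0
      where
      G = sum λ j → g j * y j
      y≡0-off : ∀ {i} → i ≢ k → y i ≡ 0ℚ
      y≡0-off {i} i≢k = begin
        y i                       ≡⟨ sym (ℚₚ.+-identityʳ (y i)) ⟩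
        y i + 0ℚ                  ≡⟨ cong (y i +_) (sym (ℚₚ.*-zeroʳ (- G))) ⟩
        y i + (- G) * 0ℚ          ≡⟨ cong (λ t → y i + (- G) * t) (sym (basis-off i≢k)) ⟩
        y i + (- G) * basis k i   ≡⟨ shifted≡0 i ⟩
        0ℚ                        ∎
      G≡0 : G ≡ 0ℚ
      G≡0 = sum-zero _ term≡0
        where
        term≡0 : ∀ j → g j * y j ≡ 0ℚ
        term≡0 j with j ≟ k
        ... | yes refl = trans (cong (_* y k) gₖ≡0) (ℚₚ.*-zeroˡ (y k))
        ... | no j≢k   = trans (cong (g j *_) (y≡0-off j≢k)) (ℚₚ.*-zeroʳ (g j))
      y≡0 : ∀ i → y i ≡ 0ℚ
      y≡0 i with i ≟ k
      ... | no i≢k   = y≡0-off i≢k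
      ... | yes refl = begin
        y i                       ≡⟨ sym (ℚₚ.+-identityʳ (y i)) ⟩
        y i + 0ℚ                  ≡⟨ cong (y i +_) (sym (ℚₚ.*-zeroˡ (basis i i))) ⟩
        y i + 0ℚ * basis i i      ≡⟨ cong (λ t → y i + (- t) * basis i i) (sym G≡0) ⟩
        y i + (- G) * basis i i   ≡⟨ shifted≡0 i ⟩
        0ℚ                        ∎

    positiveDefinite-transvected : PositiveDefiniteℚ M → PositiveDefiniteℚ transvected
    positiveDefinite-transvected pd = positiveDefinite⇐ λ where
      y (i , yᵢ≢0) → subst (0ℚ <_) (sym (quadForm-transvected y))
        (positiveDefinite⇒ pd (shifted y)
          (¬∀⟶∃¬ n (λ j → shifted y j ≡ 0ℚ) (λ j → shifted y j ℚₚ.≟ 0ℚ)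
                 (λ shifted≡0 → yᵢ≢0 (shifted-injective y shifted≡0 i))))

-- Integers inside ℚ, and signs

-- ι z = z / 1 is stuck for a variable z (it normalises through a gcd), but the sum or product
-- of mkℚ a 0 _ and mkℚ b 0 _ unfolds to (a ℤ.* 1 ℤ.+ b ℤ.* 1) / 1, resp. (a ℤ.* b) / 1.
ι≡mkℚ : ∀ z → ι z ≡ mkℚ z 0 (Coprime.sym (Coprime.1-coprimeTo ∣ z ∣))
ι≡mkℚ z = ℚₚ.↥p/↧p≡p (mkℚ z 0 (Coprime.sym (Coprime.1-coprimeTo ∣ z ∣)))

ι-* : ∀ a b → ι (a ℤ.* b) ≡ ι a * ι b
ι-* a b = sym (cong₂ _*_ (ι≡mkℚ a) (ι≡mkℚ b))

ι-*₃ : ∀ a b c → ι (a ℤ.* b ℤ.* c) ≡ ι a * ι b * ι c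
ι-*₃ a b c = trans (ι-* (a ℤ.* b) c) (cong (_* ι c) (ι-* a b))

ι-+ : ∀ a b → ι (a ℤ.+ b) ≡ ι a + ι b
ι-+ a b = trans (cong₂ (λ x y → ι (x ℤ.+ y)) (sym (ℤₚ.*-identityʳ a)) (sym (ℤₚ.*-identityʳ b)))
                (sym (cong₂ _+_ (ι≡mkℚ a) (ι≡mkℚ b)))

ι-neg : ∀ a → ι (ℤ.- a) ≡ - ι a
ι-neg a = begin
  ι (ℤ.- a)        ≡⟨ cong ι (sym (ℤₚ.-1*i≡-i a)) ⟩
  ι (-1ℤ ℤ.* a)    ≡⟨ ι-* -1ℤ a ⟩
  ι -1ℤ * ι a      ≡⟨ sym (ℚₚ.neg-distribˡ-* 1ℚ (ι a)) ⟩
  - (1ℚ * ι a)     ≡⟨ cong -_ (ℚₚ.*-identityˡ (ι a)) ⟩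
  - ι a            ∎

ι-- : ∀ a b → ι (a ℤ.- b) ≡ ι a - ι b
ι-- a b = trans (ι-+ a (ℤ.- b)) (cong (ι a +_) (ι-neg b))

ι-mono-≤ : ∀ {a b} → a ℤ.≤ b → ι a ≤ ι b
ι-mono-≤ {a} {b} a≤b rewrite ι≡mkℚ a | ι≡mkℚ b =
  ℚ.*≤* (subst₂ ℤ._≤_ (sym (ℤₚ.*-identityʳ a)) (sym (ℤₚ.*-identityʳ b)) a≤b)

ι-mono-< : ∀ {a b} → a ℤ.< b → ι a < ι b
ι-mono-< {a} {b} a<b rewrite ι≡mkℚ a | ι≡mkℚ b =
  ℚ.*<* (subst₂ ℤ._<_ (sym (ℤₚ.*-identityʳ a)) (sym (ℤₚ.*-identityʳ b)) a<b)

*-pos : ∀ {p q} → 0ℚ < p → 0ℚ < q → 0ℚ < p * q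
*-pos {p} {q} 0<p 0<q = ℚₚ.positive⁻¹ _ {{ℚₚ.pos*pos⇒pos p {{ℚ.positive 0<p}} q {{ℚ.positive 0<q}}}}

*-pos-neg : ∀ {p q} → 0ℚ < p → q < 0ℚ → p * q < 0ℚ
*-pos-neg {p} {q} 0<p q<0 = ℚₚ.negative⁻¹ _ {{ℚₚ.pos*neg⇒neg p {{ℚ.positive 0<p}} q {{ℚ.negative q<0}}}}

*-pos-nonpos : ∀ {p q} → 0ℚ < p → q ≤ 0ℚ → p * q ≤ 0ℚ
*-pos-nonpos {p} {q} 0<p q≤0 =
  subst (p * q ≤_) (ℚₚ.*-zeroʳ p) (ℚₚ.*-monoˡ-≤-nonNeg p {{ℚ.nonNegative (ℚₚ.<⇒≤ 0<p)}} q≤0)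

sgn-↥-pos : ∀ {q} → 0ℚ < q → sgn (ℚ.↥ q) ≡ 1ℤ
sgn-↥-pos {mkℚ +[1+ _ ] _ _} _ = refl
sgn-↥-pos {mkℚ +0       _ _} (ℚ.*<* (ℤ.+<+ ()))
sgn-↥-pos {mkℚ -[1+ _ ] _ _} (ℚ.*<* ())

sgn-↥-neg : ∀ {q} → q < 0ℚ → sgn (ℚ.↥ q) ≡ -1ℤ
sgn-↥-neg {mkℚ -[1+ _ ] _ _} _ = refl
sgn-↥-neg {mkℚ +0       _ _} (ℚ.*<* (ℤ.+<+ ()))
sgn-↥-neg {mkℚ +[1+ _ ] _ _} (ℚ.*<* (ℤ.+<+ ()))

sgn-↥-scaled : ∀ {d} → 0ℚ < d → ∀ x → sgn (ℚ.↥ (d * ι x)) ≡ sgn x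
sgn-↥-scaled {d} 0<d +0             = cong (λ q → sgn (ℚ.↥ q)) (ℚₚ.*-zeroʳ d)
sgn-↥-scaled {d} 0<d x@(+[1+ _ ]) = sgn-↥-pos {d * ι x} (*-pos 0<d (ι-mono-< {0ℤ} {x} (ℤ.+<+ (ℕ.s≤s ℕ.z≤n))))
sgn-↥-scaled {d} 0<d x@(-[1+ _ ]) = sgn-↥-neg {d * ι x} (*-pos-neg 0<d (ι-mono-< {x} {0ℤ} ℤ.-<+))

sgn-cancel-scaled : ∀ {d d′} → 0ℚ < d → 0ℚ < d′ → ∀ x y → d * ι x ≡ d′ * ι y → sgn x ≡ sgn y
sgn-cancel-scaled 0<d 0<d′ x y dx≡d′y =
  trans (sym (sgn-↥-scaled 0<d x)) (trans (cong (λ q → sgn (ℚ.↥ q)) dx≡d′y) (sgn-↥-scaled 0<d′ y))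

sgn-* : ∀ x y → sgn (x ℤ.* y) ≡ sgn x ℤ.* sgn y
sgn-* +0       y        = refl
sgn-* +[1+ m ] +0       = cong sgn (ℤₚ.*-zeroʳ +[1+ m ])
sgn-* +[1+ _ ] +[1+ _ ] = refl
sgn-* +[1+ _ ] -[1+ _ ] = refl
sgn-* -[1+ m ] +0       = cong sgn (ℤₚ.*-zeroʳ -[1+ m ])
sgn-* -[1+ _ ] +[1+ _ ] = refl
sgn-* -[1+ _ ] -[1+ _ ] = refl

sgn-*₃ : ∀ x y z → sgn (x ℤ.* y ℤ.* z) ≡ sgn x ℤ.* sgn y ℤ.* sgn z
sgn-*₃ x y z = trans (sgn-* (x ℤ.* y) z) (cong (ℤ._* sgn z) (sgn-* x y))

sgn-neg : ∀ x → sgn (ℤ.- x) ≡ ℤ.- sgn x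
sgn-neg +0       = refl
sgn-neg +[1+ _ ] = refl
sgn-neg -[1+ _ ] = refl

sgn-<0 : ∀ {x} → x ℤ.< 0ℤ → sgn x ≡ -1ℤ
sgn-<0 { -[1+ _ ]} _ = refl
sgn-<0 {+0}        (ℤ.+<+ ())
sgn-<0 {+[1+ _ ]}  (ℤ.+<+ ())

sgn≡-1⇒≤-1 : ∀ {x} → sgn x ≡ -1ℤ → x ℤ.≤ -1ℤ
sgn≡-1⇒≤-1 { -[1+ _ ]} _ = ℤ.-≤- ℕ.z≤n
sgn≡-1⇒≤-1 {+0}        ()
sgn≡-1⇒≤-1 {+[1+ _ ]}  ()

same-sgn⇒1≤* : ∀ {x y} → sgn x ≡ sgn y → x ≢ 0ℤ → 1ℤ ℤ.≤ x ℤ.* y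
same-sgn⇒1≤* {+0}                    _ x≢0 = ⊥-elim (x≢0 refl)
same-sgn⇒1≤* {+[1+ _ ]} {+[1+ _ ]}   _ _   = ℤ.+≤+ (ℕ.s≤s ℕ.z≤n)
same-sgn⇒1≤* { -[1+ _ ]} { -[1+ _ ]} _ _   = ℤ.+≤+ (ℕ.s≤s ℕ.z≤n)
same-sgn⇒1≤* {+[1+ _ ]} {+0}         ()
same-sgn⇒1≤* {+[1+ _ ]} { -[1+ _ ]}  ()
same-sgn⇒1≤* { -[1+ _ ]} {+0}        ()
same-sgn⇒1≤* { -[1+ _ ]} {+[1+ _ ]}  ()

*₃≡-1⇒≢0 : ∀ {x y z} → x ℤ.* y ℤ.* z ≡ -1ℤ → x ≢ 0ℤ × y ≢ 0ℤ × z ≢ 0ℤ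
*₃≡-1⇒≢0 {x} {y} {z} xyz≡-1 =
    (λ { refl → 0≢-1 xyz≡-1 })
  , (λ { refl → 0≢-1 (trans (sym (cong (ℤ._* z) (ℤₚ.*-zeroʳ x))) xyz≡-1) })
  , (λ { refl → 0≢-1 (trans (sym (ℤₚ.*-zeroʳ (x ℤ.* y))) xyz≡-1) })
  where
  0≢-1 : 0ℤ ≢ -1ℤ
  0≢-1 ()

opposite-sgn⇒≡0 : ∀ {x} → sgn x ≡ ℤ.- sgn x → x ≡ 0ℤ
opposite-sgn⇒≡0 {+0}        _ = refl
opposite-sgn⇒≡0 {+[1+ _ ]}  ()
opposite-sgn⇒≡0 { -[1+ _ ]} ()

opposite-sgn-pos : ∀ {x y} → sgn y ≡ ℤ.- sgn x → 0ℤ ℤ.< x → y ℤ.< 0ℤ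
opposite-sgn-pos {+[1+ _ ]} { -[1+ _ ]} _ _ = ℤ.-<+
opposite-sgn-pos {+[1+ _ ]} {+0}        ()
opposite-sgn-pos {+[1+ _ ]} {+[1+ _ ]}  ()
opposite-sgn-pos {+0}        _ (ℤ.+<+ ())
opposite-sgn-pos { -[1+ _ ]} _ ()

opposite-sgn-neg : ∀ {x y} → sgn y ≡ ℤ.- sgn x → x ℤ.< 0ℤ → 0ℤ ℤ.< y
opposite-sgn-neg { -[1+ _ ]} {+[1+ _ ]}  _ _ = ℤ.+<+ (ℕ.s≤s ℕ.z≤n)
opposite-sgn-neg { -[1+ _ ]} {+0}        ()
opposite-sgn-neg { -[1+ _ ]} { -[1+ _ ]} ()
opposite-sgn-neg {+0}        _ (ℤ.+<+ ())
opposite-sgn-neg {+[1+ _ ]}  _ (ℤ.+<+ ())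

opposite-sgn-nonpos : ∀ {x y} → sgn y ≡ ℤ.- sgn x → x ℤ.≤ 0ℤ → 0ℤ ℤ.≤ y
opposite-sgn-nonpos {+0}        {+0}        _ _ = ℤ.+≤+ ℕ.z≤n
opposite-sgn-nonpos { -[1+ _ ]} {+[1+ _ ]}  _ _ = ℤ.+≤+ ℕ.z≤n
opposite-sgn-nonpos {+0}        {+[1+ _ ]}  ()
opposite-sgn-nonpos {+0}        { -[1+ _ ]} ()
opposite-sgn-nonpos { -[1+ _ ]} {+0}        ()
opposite-sgn-nonpos { -[1+ _ ]} { -[1+ _ ]} ()
opposite-sgn-nonpos {+[1+ _ ]}  _ (ℤ.+≤+ ())

-- Positive quasi-Cartan matrices

two : ℚ
two = 1ℚ + 1ℚ

-‿mono-≤ : ∀ {p p′ q q′} → p ≤ p′ → q′ ≤ q → p - q ≤ p′ - q′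
-‿mono-≤ p≤p′ q′≤q = ℚₚ.+-mono-≤ p≤p′ (ℚₚ.neg-antimono-≤ q′≤q)

two*-mono-≤ : ∀ {p q} → p ≤ q → two * p ≤ two * q
two*-mono-≤ = ℚₚ.*-monoˡ-≤-nonNeg two

det₃≤0 : ∀ {aa bb cc ab ba bc cb ca ac : ℚ} → aa ≡ two → bb ≡ two → cc ≡ two →
  ab * bc * ca ≤ - 1ℚ → ac * ba * cb ≤ - 1ℚ → 1ℚ ≤ ab * ba → 1ℚ ≤ bc * cb → 1ℚ ≤ ac * ca →
  aa * bb * cc + ab * bc * ca + ac * ba * cb - aa * bc * cb - bb * ac * ca - cc * ab * ba ≤ 0ℚ
det₃≤0 {ab = ab} {ba} {bc} {cb} {ca} {ac} refl refl refl t≤-1 t′≤-1 1≤ab·ba 1≤bc·cb 1≤ac·ca =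
  ℚₚ.≤-trans (ℚₚ.≤-reflexive (regroup (ab * bc * ca) (ac * ba * cb) ab ba bc cb ca ac))
    (-‿mono-≤ (-‿mono-≤ (-‿mono-≤ (ℚₚ.+-mono-≤ (ℚₚ.+-monoʳ-≤ (two * two * two) t≤-1) t′≤-1)
      (two*-mono-≤ 1≤bc·cb)) (two*-mono-≤ 1≤ac·ca)) (two*-mono-≤ 1≤ab·ba))
  where
  regroup : ∀ t t′ ab ba bc cb ca ac →
    two * two * two + t + t′ - two * bc * cb - two * ac * ca - two * ab * ba
      ≡ two * two * two + t + t′ - two * (bc * cb) - two * (ac * ca) - two * (ab * ba)
  regroup = solve 8 (λ t t′ ab ba bc cb ca ac →
    con two :* con two :* con two :+ t :+ t′ :- con two :* bc :* cb :- con two :* ac :* ca :- con two :* ab :* ba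
      := con two :* con two :* con two :+ t :+ t′ :- con two :* (bc :* cb) :- con two :* (ac :* ca)
           :- con two :* (ab :* ba)) refl

module PositiveQuasiCartanProperties {n} {A : Matrix n} {d : Fin n → ℚ}
  (d>0 : PositiveDiagonal d) (symmetric : Symmetricℚ (diagMul d A))
  (diagonal : ∀ i → A i i ≡ ℤ.+ 2) (pd : PositiveDefiniteℚ (diagMul d A)) where

  sgn-symmetric : ∀ i j → sgn (A i j) ≡ sgn (A j i)
  sgn-symmetric i j = sgn-cancel-scaled (d>0 i) (d>0 j) (A i j) (A j i) (symmetric i j)

  α : Fin n → Fin n → ℚ
  α i j = ι (A i j)

  det₃-diagMul : ∀ a b c → det₃ (diagMul d A) a b c ≡ (d a * d b * d c) * det₃ α a b c
  det₃-diagMul a b c =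
    scale (d a) (d b) (d c) (α a a) (α a b) (α a c) (α b a) (α b b) (α b c) (α c a) (α c b) (α c c)
    where
    scale : ∀ da db dc maa mab mac mba mbb mbc mca mcb mcc →
      (da * maa) * (db * mbb) * (dc * mcc) + (da * mab) * (db * mbc) * (dc * mca)
        + (da * mac) * (db * mba) * (dc * mcb) - (da * maa) * (db * mbc) * (dc * mcb)
        - (db * mbb) * (da * mac) * (dc * mca) - (dc * mcc) * (da * mab) * (db * mba)
      ≡ (da * db * dc) * (maa * mbb * mcc + mab * mbc * mca + mac * mba * mcb
                          - maa * mbc * mcb - mbb * mac * mca - mcc * mab * mba)
    scale = solve 12 (λ da db dc maa mab mac mba mbb mbc mca mcb mcc →
      (da :* maa) :* (db :* mbb) :* (dc :* mcc) :+ (da :* mab) :* (db :* mbc) :* (dc :* mca)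
        :+ (da :* mac) :* (db :* mba) :* (dc :* mcb) :- (da :* maa) :* (db :* mbc) :* (dc :* mcb)
        :- (db :* mbb) :* (da :* mac) :* (dc :* mca) :- (dc :* mcc) :* (da :* mab) :* (db :* mba)
      := (da :* db :* dc) :* (maa :* mbb :* mcc :+ mab :* mbc :* mca :+ mac :* mba :* mcb
                              :- maa :* mbc :* mcb :- mbb :* mac :* mca :- mcc :* mab :* mba)) refl

  negative-cycle⇒det₃≤0 : ∀ a b c → sgn (A a b) ℤ.* sgn (A b c) ℤ.* sgn (A c a) ≡ -1ℤ → det₃ α a b c ≤ 0ℚ
  negative-cycle⇒det₃≤0 a b c σ≡-1 =
    det₃≤0 (cong ι (diagonal a)) (cong ι (diagonal b)) (cong ι (diagonal c))
      (cycle≤-1 (A a b) (A b c) (A c a) (trans (sgn-*₃ (A a b) (A b c) (A c a)) σ≡-1))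
      (cycle≤-1 (A a c) (A b a) (A c b) (trans reversed-cycle σ≡-1))
      (pair≥1 a b σab≢0) (pair≥1 b c σbc≢0) (pair≥1 a c σac≢0)
    where
    nonzero = *₃≡-1⇒≢0 σ≡-1
    σab≢0 = proj₁ nonzero
    σbc≢0 = proj₁ (proj₂ nonzero)
    σac≢0 : sgn (A a c) ≢ 0ℤ
    σac≢0 = subst (_≢ 0ℤ) (sgn-symmetric c a) (proj₂ (proj₂ nonzero))
    cycle≤-1 : ∀ x y z → sgn (x ℤ.* y ℤ.* z) ≡ -1ℤ → ι x * ι y * ι z ≤ - 1ℚ
    cycle≤-1 x y z σ≡-1 = subst (_≤ - 1ℚ) (ι-*₃ x y z) (ι-mono-≤ (sgn≡-1⇒≤-1 σ≡-1))
    pair≥1 : ∀ i j → sgn (A i j) ≢ 0ℤ → 1ℚ ≤ α i j * α j i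
    pair≥1 i j σᵢⱼ≢0 =
      subst (1ℚ ≤_) (ι-* (A i j) (A j i)) (ι-mono-≤ (same-sgn⇒1≤* (sgn-symmetric i j) (σᵢⱼ≢0 ∘ cong sgn)))
    reversed-cycle : sgn (A a c ℤ.* A b a ℤ.* A c b) ≡ sgn (A a b) ℤ.* sgn (A b c) ℤ.* sgn (A c a)
    reversed-cycle = begin
      sgn (A a c ℤ.* A b a ℤ.* A c b)
        ≡⟨ sgn-*₃ (A a c) (A b a) (A c b) ⟩
      sgn (A a c) ℤ.* sgn (A b a) ℤ.* sgn (A c b)
        ≡⟨ cong₂ ℤ._*_ (cong₂ ℤ._*_ (sgn-symmetric a c) (sgn-symmetric b a)) (sgn-symmetric c b) ⟩
      sgn (A c a) ℤ.* sgn (A a b) ℤ.* sgn (A b c)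
        ≡⟨ rotate (sgn (A c a)) (sgn (A a b)) (sgn (A b c)) ⟩
      sgn (A a b) ℤ.* sgn (A b c) ℤ.* sgn (A c a) ∎
      where
      rotate : ∀ x y z → x ℤ.* y ℤ.* z ≡ y ℤ.* z ℤ.* x
      rotate = ℤ-Solver.solve-∀

  0≤direct*path : ∀ {a b c} → a ≢ b → a ≢ c → b ≢ c → 0ℤ ℤ.≤ A a c ℤ.* (A a b ℤ.* A b c)
  0≤direct*path {a} {b} {c} a≢b a≢c b≢c = ℤₚ.≮⇒≥ λ product<0 →
    ℚₚ.<-irrefl refl (ℚₚ.<-≤-trans (positiveDefinite-det₃ pd a≢b a≢c b≢c)
      (subst (_≤ 0ℚ) (sym (det₃-diagMul a b c))
        (*-pos-nonpos (*-pos (*-pos (d>0 a) (d>0 b)) (d>0 c))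
          (negative-cycle⇒det₃≤0 a b c (trans (sym product-sgn) (sgn-<0 product<0))))))
    where
    product-sgn : sgn (A a c ℤ.* (A a b ℤ.* A b c)) ≡ sgn (A a b) ℤ.* sgn (A b c) ℤ.* sgn (A c a)
    product-sgn = begin
      sgn (A a c ℤ.* (A a b ℤ.* A b c))
        ≡⟨ trans (sgn-* (A a c) (A a b ℤ.* A b c)) (cong (sgn (A a c) ℤ.*_) (sgn-* (A a b) (A b c))) ⟩
      sgn (A a c) ℤ.* (sgn (A a b) ℤ.* sgn (A b c))
        ≡⟨ cong (ℤ._* (sgn (A a b) ℤ.* sgn (A b c))) (sgn-symmetric a c) ⟩
      sgn (A c a) ℤ.* (sgn (A a b) ℤ.* sgn (A b c))
        ≡⟨ ℤₚ.*-comm (sgn (A c a)) (sgn (A a b) ℤ.* sgn (A b c)) ⟩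
      sgn (A a b) ℤ.* sgn (A b c) ℤ.* sgn (A c a) ∎

-- Skew-symmetrizable matrices

module SkewSymmetrizableProperties {n} {B : Matrix n} {d : Fin n → ℚ}
  (d>0 : PositiveDiagonal d) (skew : SkewSymmetricℚ (diagMul d B)) where

  sgn-skew : ∀ i j → sgn (B j i) ≡ ℤ.- sgn (B i j)
  sgn-skew i j = trans (sgn-cancel-scaled (d>0 j) (d>0 i) (B j i) (ℤ.- B i j) scaled) (sgn-neg (B i j))
    where
    scaled : d j * ι (B j i) ≡ d i * ι (ℤ.- B i j)
    scaled = begin
      d j * ι (B j i)      ≡⟨ skew j i ⟩
      - (d i * ι (B i j))  ≡⟨ ℚₚ.neg-distribʳ-* (d i) (ι (B i j)) ⟩
      d i * - ι (B i j)    ≡⟨ cong (d i *_) (sym (ι-neg (B i j))) ⟩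
      d i * ι (ℤ.- B i j)  ∎

  diagonal-zero : ∀ i → B i i ≡ 0ℤ
  diagonal-zero i = opposite-sgn⇒≡0 (sgn-skew i i)

  arrow-reverse : ∀ {i j} → Arrow B i j → B j i ℤ.< 0ℤ
  arrow-reverse = opposite-sgn-pos (sgn-skew _ _)

  negative-reverse : ∀ {i j} → B i j ℤ.< 0ℤ → Arrow B j i
  negative-reverse = opposite-sgn-neg (sgn-skew _ _)

  nonpositive-reverse : ∀ {i j} → B i j ℤ.≤ 0ℤ → 0ℤ ℤ.≤ B j i
  nonpositive-reverse = opposite-sgn-nonpos (sgn-skew _ _)

  no-loop : ∀ {i} → ¬ Arrow B i i
  no-loop {i} = ℤₚ.<-irrefl (sym (diagonal-zero i))

  no-2-cycle : ∀ {i j} → Arrow B i j → ¬ Arrow B j i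
  no-2-cycle i→j j→i = ℤₚ.<-asym j→i (arrow-reverse i→j)

  arrow-distinct : ∀ {i j} → Arrow B i j → i ≢ j
  arrow-distinct i→j refl = no-loop i→j

  next³ : ∀ (t : Fin 3) → next (next (next t)) ≡ t
  next³ 0F = refl
  next³ 1F = refl
  next³ 2F = refl

  no-transitive-triangle : AllChordlessCyclesCyclicallyOriented B →
    ∀ {a b c} → Arrow B a b → Arrow B b c → Arrow B a c → ⊥
  no-transitive-triangle oriented {a} {b} {c} a→b b→c a→c =
    a-has-no-predecessor (oriented 0 v (injective , edges))
    where
    v : Fin 3 → Fin n
    v 0F = a
    v 1F = b
    v 2F = c
    no-arrow-into-a : ∀ s → ¬ Arrow B (v s) a
    no-arrow-into-a 0F = no-loop
    no-arrow-into-a 1F = no-2-cycle a→b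
    no-arrow-into-a 2F = no-2-cycle a→c
    injective : ∀ x y → v x ≡ v y → x ≡ y
    injective 0F 0F _   = refl
    injective 0F 1F a≡b = ⊥-elim (arrow-distinct a→b a≡b)
    injective 0F 2F a≡c = ⊥-elim (arrow-distinct a→c a≡c)
    injective 1F 0F b≡a = ⊥-elim (arrow-distinct a→b (sym b≡a))
    injective 1F 1F _   = refl
    injective 1F 2F b≡c = ⊥-elim (arrow-distinct b→c b≡c)
    injective 2F 0F c≡a = ⊥-elim (arrow-distinct a→c (sym c≡a))
    injective 2F 1F c≡b = ⊥-elim (arrow-distinct b→c (sym c≡b))
    injective 2F 2F _   = refl
    no-edge : ∀ {x} → ¬ Edge B (v x) (v x)
    no-edge (inj₁ loop) = no-loop loop
    no-edge (inj₂ loop) = no-loop loop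
    edges : ∀ x y → Edge B (v x) (v y) ⇔ (y ≡ next x ⊎ x ≡ next y)
    edges 0F 0F = mk⇔ (⊥-elim ∘ no-edge) λ { (inj₁ ()) ; (inj₂ ()) }
    edges 0F 1F = mk⇔ (λ _ → inj₁ refl) (λ _ → inj₁ a→b)
    edges 0F 2F = mk⇔ (λ _ → inj₂ refl) (λ _ → inj₁ a→c)
    edges 1F 0F = mk⇔ (λ _ → inj₂ refl) (λ _ → inj₂ a→b)
    edges 1F 1F = mk⇔ (⊥-elim ∘ no-edge) λ { (inj₁ ()) ; (inj₂ ()) }
    edges 1F 2F = mk⇔ (λ _ → inj₁ refl) (λ _ → inj₁ b→c)
    edges 2F 0F = mk⇔ (λ _ → inj₁ refl) (λ _ → inj₂ a→c)
    edges 2F 1F = mk⇔ (λ _ → inj₂ refl) (λ _ → inj₂ b→c)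
    edges 2F 2F = mk⇔ (⊥-elim ∘ no-edge) λ { (inj₁ ()) ; (inj₂ ()) }
    -- a is a source of the triangle, yet in a cyclic orientation w every vertex w t has the
    -- incoming arrow w (t − 1) → w t, and t − 1 = next (next t) in ℤ/3ℤ.
    a-has-no-predecessor : ¬ CyclicallyOriented B 0 v
    a-has-no-predecessor (w , (v⊆w , w⊆v) , _ , w-arrows) =
      let t , a≡wt    = v⊆w 0F
          s , pred≡vs = w⊆v (next (next t))
      in no-arrow-into-a s
           (subst₂ (Arrow B) pred≡vs (trans (cong w (next³ t)) (sym a≡wt)) (w-arrows (next (next t))))

-- Mutation

-- For p, q ≢ k, μ k B p q = B p q ℤ.+ correction (B p k) (B k q).
correction : ℤ → ℤ → ℤ
correction x y = sgn x ℤ.* [ x ℤ.* y ]₊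

correction-vanishes : ∀ x y → x ℤ.* y ℤ.≤ 0ℤ → correction x y ≡ 0ℤ
correction-vanishes x y xy≤0 = trans (cong (sgn x ℤ.*_) (ℤₚ.i≤j⇒i⊔j≡j xy≤0)) (ℤₚ.*-zeroʳ (sgn x))

∣correction∣ : ∀ x y → 0ℤ ℤ.≤ x ℤ.* y → ∣ correction x y ∣ ≡ ∣ x ℤ.* y ∣
∣correction∣ x y 0≤xy = trans (cong (λ t → ∣ sgn x ℤ.* t ∣) (ℤₚ.i≥j⇒i⊔j≡i 0≤xy)) (∣sgn*∣ x)
  where
  ∣sgn*∣ : ∀ x → ∣ sgn x ℤ.* (x ℤ.* y) ∣ ≡ ∣ x ℤ.* y ∣
  ∣sgn*∣ +0       = refl
  ∣sgn*∣ +[1+ m ] = cong ∣_∣ (ℤₚ.*-identityˡ (+[1+ m ] ℤ.* y))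
  ∣sgn*∣ -[1+ m ] = trans (cong ∣_∣ (ℤₚ.-1*i≡-i (-[1+ m ] ℤ.* y))) (ℤₚ.∣-i∣≡∣i∣ (-[1+ m ] ℤ.* y))

*-nonneg-nonneg : ∀ {x y} → 0ℤ ℤ.≤ x → 0ℤ ℤ.≤ y → 0ℤ ℤ.≤ x ℤ.* y
*-nonneg-nonneg {y = y} 0≤x 0≤y = ℤₚ.*-monoʳ-≤-nonNeg y {{ℤ.nonNegative 0≤y}} 0≤x

*-nonpos-nonpos : ∀ {x y} → x ℤ.≤ 0ℤ → y ℤ.≤ 0ℤ → 0ℤ ℤ.≤ x ℤ.* y
*-nonpos-nonpos {y = y} x≤0 y≤0 = ℤₚ.*-monoʳ-≤-nonPos y {{ℤ.nonPositive y≤0}} x≤0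

*-nonneg-nonpos : ∀ {x y} → 0ℤ ℤ.≤ x → y ℤ.≤ 0ℤ → x ℤ.* y ℤ.≤ 0ℤ
*-nonneg-nonpos {y = y} 0≤x y≤0 = ℤₚ.*-monoʳ-≤-nonPos y {{ℤ.nonPositive y≤0}} 0≤x

*-nonpos-nonneg : ∀ {x y} → x ℤ.≤ 0ℤ → 0ℤ ℤ.≤ y → x ℤ.* y ℤ.≤ 0ℤ
*-nonpos-nonneg {y = y} x≤0 0≤y = ℤₚ.*-monoʳ-≤-nonNeg y {{ℤ.nonNegative 0≤y}} x≤0

correction-opposes : ∀ b x y → (0ℤ ℤ.< x → 0ℤ ℤ.< y → b ℤ.≤ 0ℤ) → (x ℤ.< 0ℤ → y ℤ.< 0ℤ → 0ℤ ℤ.≤ b) →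
  b ℤ.* correction x y ℤ.≤ 0ℤ
correction-opposes b = by-signs
  where
  vanishing : ∀ x y → x ℤ.* y ℤ.≤ 0ℤ → b ℤ.* correction x y ℤ.≤ 0ℤ
  vanishing x y xy≤0 = ℤₚ.≤-reflexive (trans (cong (b ℤ.*_) (correction-vanishes x y xy≤0)) (ℤₚ.*-zeroʳ b))
  by-signs : ∀ x y → (0ℤ ℤ.< x → 0ℤ ℤ.< y → b ℤ.≤ 0ℤ) → (x ℤ.< 0ℤ → y ℤ.< 0ℤ → 0ℤ ℤ.≤ b) →
    b ℤ.* correction x y ℤ.≤ 0ℤ
  by-signs +0             _              _   _   = ℤₚ.≤-reflexive (ℤₚ.*-zeroʳ b)
  by-signs +[1+ _ ]       +[1+ _ ]       b≤0 _   =
    *-nonpos-nonneg (b≤0 (ℤ.+<+ (ℕ.s≤s ℕ.z≤n)) (ℤ.+<+ (ℕ.s≤s ℕ.z≤n))) (ℤ.+≤+ ℕ.z≤n)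
  by-signs -[1+ _ ]       -[1+ _ ]       _   0≤b = *-nonneg-nonpos (0≤b ℤ.-<+ ℤ.-<+) ℤ.-≤+
  by-signs x@(+[1+ _ ]) y@(+0)       _ _ = vanishing x y (ℤₚ.≤-reflexive (ℤₚ.*-zeroʳ x))
  by-signs x@(+[1+ _ ]) y@(-[1+ _ ]) _ _ = vanishing x y ℤ.-≤+
  by-signs x@(-[1+ _ ]) y@(+0)       _ _ = vanishing x y (ℤₚ.≤-reflexive (ℤₚ.*-zeroʳ x))
  by-signs x@(-[1+ _ ]) y@(+[1+ _ ]) _ _ = vanishing x y ℤ.-≤+

∣i-j∣≡∣∣i∣⊖∣j∣∣ : ∀ i j → 0ℤ ℤ.≤ i ℤ.* j → ∣ i ℤ.- j ∣ ≡ ∣ ∣ i ∣ ℤ.⊖ ∣ j ∣ ∣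
∣i-j∣≡∣∣i∣⊖∣j∣∣ (ℤ.+ m)  (ℤ.+ n)  _ = cong ∣_∣ (ℤₚ.[+m]-[+n]≡m⊖n m n)
∣i-j∣≡∣∣i∣⊖∣j∣∣ +0       -[1+ _ ] _ = refl
∣i-j∣≡∣∣i∣⊖∣j∣∣ -[1+ _ ] +0       _ = refl
∣i-j∣≡∣∣i∣⊖∣j∣∣ -[1+ m ] -[1+ n ] _ = ℤₚ.∣m⊖n∣≡∣n⊖m∣ (suc n) (suc m)
∣i-j∣≡∣∣i∣⊖∣j∣∣ +[1+ _ ] -[1+ _ ] ()
∣i-j∣≡∣∣i∣⊖∣j∣∣ -[1+ _ ] +[1+ _ ] ()

∣i+j∣≡∣∣i∣⊖∣j∣∣ : ∀ i j → i ℤ.* j ℤ.≤ 0ℤ → ∣ i ℤ.+ j ∣ ≡ ∣ ∣ i ∣ ℤ.⊖ ∣ j ∣ ∣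
∣i+j∣≡∣∣i∣⊖∣j∣∣ i j ij≤0 = begin
  ∣ i ℤ.+ j ∣
    ≡⟨ cong (λ t → ∣ i ℤ.+ t ∣) (sym (ℤₚ.neg-involutive j)) ⟩
  ∣ i ℤ.- ℤ.- j ∣
    ≡⟨ ∣i-j∣≡∣∣i∣⊖∣j∣∣ i (ℤ.- j) (subst (0ℤ ℤ.≤_) (ℤₚ.neg-distribʳ-* i j) (ℤₚ.neg-mono-≤ ij≤0)) ⟩
  ∣ ∣ i ∣ ℤ.⊖ ∣ ℤ.- j ∣ ∣
    ≡⟨ cong (λ t → ∣ ∣ i ∣ ℤ.⊖ t ∣) (ℤₚ.∣-i∣≡∣i∣ j) ⟩
  ∣ ∣ i ∣ ℤ.⊖ ∣ j ∣ ∣ ∎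

-- reflected is D⁻¹ times the Gram matrix of the basis in which every αₚ with p ∈ C is replaced
-- by its reflection sₖ αₚ = αₚ − Aₖₚ αₖ; coefficient p is the multiple of αₖ that is subtracted.
module RootReflection {n} (A : Matrix n) (k : Fin n) (C : Fin n → Bool) where

  reflected : Matrix n
  reflected p q = if C p xor C q then A p q ℤ.- A p k ℤ.* A k q else A p q

  coefficient : Fin n → ℚ
  coefficient p = if C p then ι (A k p) else 0ℚ

  reflected-diagonal : (∀ i → A i i ≡ ℤ.+ 2) → ∀ i → reflected i i ≡ ℤ.+ 2
  reflected-diagonal diagonal i = unchanged (C i)
    where
    unchanged : ∀ b → (if b xor b then A i i ℤ.- A i k ℤ.* A k i else A i i) ≡ ℤ.+ 2
    unchanged false = diagonal i
    unchanged true  = diagonal i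

  module _ {d : Fin n → ℚ} (d>0 : PositiveDiagonal d) (symmetric : Symmetricℚ (diagMul d A))
           (diagonal : ∀ i → A i i ≡ ℤ.+ 2) where

    open Transvection (diagMul d A) k coefficient

    diagMul-reflected : ∀ p q → diagMul d reflected p q ≡ transvected p q
    diagMul-reflected p q = entry (C p) (C q)
      where
      S = diagMul d A
      α : Fin n → Fin n → ℚ
      α i j = ι (A i j)
      ι-reflected : ι (A p q ℤ.- A p k ℤ.* A k q) ≡ α p q - α p k * α k q
      ι-reflected = trans (ι-- (A p q) (A p k ℤ.* A k q)) (cong (λ t → α p q - t) (ι-* (A p k) (A k q)))
      entry : ∀ bp bq → d p * ι (if bp xor bq then A p q ℤ.- A p k ℤ.* A k q else A p q)
        ≡ S p q - (if bp then α k p else 0ℚ) * S k q - (if bq then α k q else 0ℚ) * S p k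
            + (if bp then α k p else 0ℚ) * (if bq then α k q else 0ℚ) * S k k
      entry false false = identity (S p q) (S k q) (S p k) (S k k)
        where
        identity : ∀ s t u v → s ≡ s - 0ℚ * t - 0ℚ * u + 0ℚ * 0ℚ * v
        identity = solve 4 (λ s t u v → s := s :- con 0ℚ :* t :- con 0ℚ :* u :+ con 0ℚ :* con 0ℚ :* v) refl
      entry true false = begin
        d p * ι (A p q ℤ.- A p k ℤ.* A k q)
          ≡⟨ cong (d p *_) ι-reflected ⟩
        d p * (α p q - α p k * α k q)
          ≡⟨ expand (d p) (α p q) (α p k) (α k q) ⟩
        d p * α p q - d p * α p k * α k q
          ≡⟨ cong (λ t → d p * α p q - t * α k q) (symmetric p k) ⟩
        d p * α p q - d k * α k p * α k q
          ≡⟨ identity (d p * α p q) (d k) (α k p) (α k q) (S p k) (S k k) ⟩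
        S p q - α k p * S k q - 0ℚ * S p k + α k p * 0ℚ * S k k ∎
        where
        expand : ∀ dp apq apk akq → dp * (apq - apk * akq) ≡ dp * apq - dp * apk * akq
        expand = solve 4 (λ dp apq apk akq → dp :* (apq :- apk :* akq) := dp :* apq :- dp :* apk :* akq) refl
        identity : ∀ s dk akp akq spk skk → s - dk * akp * akq ≡ s - akp * (dk * akq) - 0ℚ * spk + akp * 0ℚ * skk
        identity = solve 6 (λ s dk akp akq spk skk →
          s :- dk :* akp :* akq := s :- akp :* (dk :* akq) :- con 0ℚ :* spk :+ akp :* con 0ℚ :* skk) refl
      entry false true = begin
        d p * ι (A p q ℤ.- A p k ℤ.* A k q)
          ≡⟨ cong (d p *_) ι-reflected ⟩
        d p * (α p q - α p k * α k q)
          ≡⟨ identity (d p) (α p q) (α p k) (α k q) (S k q) (S k k) ⟩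
        S p q - 0ℚ * S k q - α k q * S p k + 0ℚ * α k q * S k k ∎
        where
        identity : ∀ dp apq apk akq skq skk →
          dp * (apq - apk * akq) ≡ dp * apq - 0ℚ * skq - akq * (dp * apk) + 0ℚ * akq * skk
        identity = solve 6 (λ dp apq apk akq skq skk →
          dp :* (apq :- apk :* akq)
            := dp :* apq :- con 0ℚ :* skq :- akq :* (dp :* apk) :+ con 0ℚ :* akq :* skk) refl
      entry true true = sym (begin
        S p q - α k p * S k q - α k q * S p k + α k p * α k q * S k k
          ≡⟨ cong₂ (λ s t → S p q - α k p * S k q - α k q * s + α k p * α k q * (d k * t))
                   (symmetric p k) (cong ι (diagonal k)) ⟩
        S p q - α k p * S k q - α k q * (d k * α k p) + α k p * α k q * (d k * two)
          ≡⟨ identity (S p q) (d k) (α k p) (α k q) ⟩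
        S p q ∎)
        where
        identity : ∀ s dk akp akq → s - akp * (dk * akq) - akq * (dk * akp) + akp * akq * (dk * two) ≡ s
        identity = solve 4 (λ s dk akp akq →
          s :- akp :* (dk :* akq) :- akq :* (dk :* akp) :+ akp :* akq :* (dk :* con two) := s) refl

    reflected-positiveQuasiCartan : C k ≡ false → PositiveDefiniteℚ (diagMul d A) → PositiveQuasiCartan reflected
    reflected-positiveQuasiCartan Cₖ≡false pd =
      reflected-diagonal diagonal , d , d>0 , reflected-symmetric , reflected-positiveDefinite
      where
      reflected-symmetric : Symmetricℚ (diagMul d reflected)
      reflected-symmetric p q =
        trans (diagMul-reflected p q) (trans (transvected-symmetric symmetric p q) (sym (diagMul-reflected q p)))
      reflected-positiveDefinite : PositiveDefiniteℚ (diagMul d reflected)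
      reflected-positiveDefinite = positiveDefinite-cong (λ p q → sym (diagMul-reflected p q))
        (positiveDefinite-transvected (cong (λ b → if b then ι (A k k) else 0ℚ) Cₖ≡false) pd)

module MutationCompanion {n} {B A : Matrix n} {dB d : Fin n → ℚ}
  (dB>0 : PositiveDiagonal dB) (skew : SkewSymmetricℚ (diagMul dB B))
  (oriented : AllChordlessCyclesCyclicallyOriented B)
  (d>0 : PositiveDiagonal d) (symmetric : Symmetricℚ (diagMul d A)) (diagonal : ∀ i → A i i ≡ ℤ.+ 2)
  (pd : PositiveDefiniteℚ (diagMul d A)) (companion : IsCompanion A B) (k : Fin n) where

  open SkewSymmetrizableProperties {B = B} {d = dB} dB>0 skew
  open PositiveQuasiCartanProperties {A = A} {d = d} d>0 symmetric diagonal pd using (0≤direct*path)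

  pointsTo-k : Fin n → Bool
  pointsTo-k p = does (0ℤ ℤₚ.<? B p k)

  open RootReflection A k pointsTo-k public

  k-not-pointsTo-k : pointsTo-k k ≡ false
  k-not-pointsTo-k with 0ℤ ℤₚ.<? B k k
  ... | yes loop = ⊥-elim (no-loop loop)
  ... | no _     = refl

  row-k : ∀ q → ∣ reflected k q ∣ ≡ ∣ A k q ∣
  row-k q = subst (λ b → ∣ (if b xor pointsTo-k q then A k q ℤ.- A k k ℤ.* A k q else A k q) ∣ ≡ ∣ A k q ∣)
                  (sym k-not-pointsTo-k) (entry (pointsTo-k q))
    where
    entry : ∀ b → ∣ (if b then A k q ℤ.- A k k ℤ.* A k q else A k q) ∣ ≡ ∣ A k q ∣
    entry false = refl
    entry true  = begin
      ∣ A k q ℤ.- A k k ℤ.* A k q ∣   ≡⟨ cong (λ t → ∣ A k q ℤ.- t ℤ.* A k q ∣) (diagonal k) ⟩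
      ∣ A k q ℤ.- ℤ.+ 2 ℤ.* A k q ∣   ≡⟨ cong ∣_∣ (identity (A k q)) ⟩
      ∣ ℤ.- A k q ∣                   ≡⟨ ℤₚ.∣-i∣≡∣i∣ (A k q) ⟩
      ∣ A k q ∣                       ∎
      where
      identity : ∀ x → x ℤ.- ℤ.+ 2 ℤ.* x ≡ ℤ.- x
      identity = ℤ-Solver.solve-∀

  column-k : ∀ p → ∣ reflected p k ∣ ≡ ∣ A p k ∣
  column-k p = subst (λ b → ∣ (if pointsTo-k p xor b then A p k ℤ.- A p k ℤ.* A k k else A p k) ∣ ≡ ∣ A p k ∣)
                     (sym k-not-pointsTo-k) (entry (pointsTo-k p))
    where
    entry : ∀ b → ∣ (if b xor false then A p k ℤ.- A p k ℤ.* A k k else A p k) ∣ ≡ ∣ A p k ∣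
    entry false = refl
    entry true  = begin
      ∣ A p k ℤ.- A p k ℤ.* A k k ∣   ≡⟨ cong (λ t → ∣ A p k ℤ.- A p k ℤ.* t ∣) (diagonal k) ⟩
      ∣ A p k ℤ.- A p k ℤ.* ℤ.+ 2 ∣   ≡⟨ cong ∣_∣ (identity (A p k)) ⟩
      ∣ ℤ.- A p k ∣                   ≡⟨ ℤₚ.∣-i∣≡∣i∣ (A p k) ⟩
      ∣ A p k ∣                       ∎
      where
      identity : ∀ x → x ℤ.- x ℤ.* ℤ.+ 2 ≡ ℤ.- x
      identity = ℤ-Solver.solve-∀

  module _ {p q} (p≢q : p ≢ q) (p≢k : p ≢ k) (q≢k : q ≢ k) where

    B-opposes-correction : B p q ℤ.* correction (B p k) (B k q) ℤ.≤ 0ℤ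
    B-opposes-correction = correction-opposes (B p q) (B p k) (B k q)
      (λ p→k k→q → ℤₚ.≮⇒≥ (no-transitive-triangle oriented p→k k→q))
      (λ Bpk<0 Bkq<0 → nonpositive-reverse
        (ℤₚ.≮⇒≥ (no-transitive-triangle oriented (negative-reverse Bkq<0) (negative-reverse Bpk<0))))

    unchanged : B p k ℤ.* B k q ℤ.≤ 0ℤ → ∣ A p q ∣ ≡ ∣ B p q ℤ.+ correction (B p k) (B k q) ∣
    unchanged xy≤0 = trans (companion p q p≢q) (cong ∣_∣ (sym (trans
      (cong (λ t → B p q ℤ.+ t) (correction-vanishes (B p k) (B k q) xy≤0)) (ℤₚ.+-identityʳ (B p q)))))

    changed : 0ℤ ℤ.≤ B p k ℤ.* B k q → ∣ A p q ℤ.- A p k ℤ.* A k q ∣ ≡ ∣ B p q ℤ.+ correction (B p k) (B k q) ∣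
    changed 0≤xy = begin
      ∣ A p q ℤ.- A p k ℤ.* A k q ∣
        ≡⟨ ∣i-j∣≡∣∣i∣⊖∣j∣∣ (A p q) (A p k ℤ.* A k q) (0≤direct*path p≢k p≢q (q≢k ∘ sym)) ⟩
      ∣ ∣ A p q ∣ ℤ.⊖ ∣ A p k ℤ.* A k q ∣ ∣
        ≡⟨ cong₂ (λ s t → ∣ s ℤ.⊖ t ∣) (companion p q p≢q) ∣AA∣≡∣BB∣ ⟩
      ∣ ∣ B p q ∣ ℤ.⊖ ∣ B p k ℤ.* B k q ∣ ∣
        ≡⟨ cong (λ t → ∣ ∣ B p q ∣ ℤ.⊖ t ∣) (sym (∣correction∣ (B p k) (B k q) 0≤xy)) ⟩
      ∣ ∣ B p q ∣ ℤ.⊖ ∣ correction (B p k) (B k q) ∣ ∣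
        ≡⟨ sym (∣i+j∣≡∣∣i∣⊖∣j∣∣ (B p q) (correction (B p k) (B k q)) B-opposes-correction) ⟩
      ∣ B p q ℤ.+ correction (B p k) (B k q) ∣ ∎
      where
      ∣AA∣≡∣BB∣ : ∣ A p k ℤ.* A k q ∣ ≡ ∣ B p k ℤ.* B k q ∣
      ∣AA∣≡∣BB∣ = begin
        ∣ A p k ℤ.* A k q ∣       ≡⟨ ℤₚ.abs-* (A p k) (A k q) ⟩
        ∣ A p k ∣ ℕ.* ∣ A k q ∣   ≡⟨ cong₂ ℕ._*_ (companion p k p≢k) (companion k q (q≢k ∘ sym)) ⟩
        ∣ B p k ∣ ℕ.* ∣ B k q ∣   ≡⟨ sym (ℤₚ.abs-* (B p k) (B k q)) ⟩
        ∣ B p k ℤ.* B k q ∣       ∎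

    off-diagonal : (p→k? : Dec (0ℤ ℤ.< B p k)) (q→k? : Dec (0ℤ ℤ.< B q k)) →
      ∣ (if does p→k? xor does q→k? then A p q ℤ.- A p k ℤ.* A k q else A p q) ∣
        ≡ ∣ B p q ℤ.+ correction (B p k) (B k q) ∣
    off-diagonal (yes p→k) (yes q→k) = unchanged (*-nonneg-nonpos (ℤₚ.<⇒≤ p→k) (ℤₚ.<⇒≤ (arrow-reverse q→k)))
    off-diagonal (no p↛k)  (no q↛k)  = unchanged (*-nonpos-nonneg (ℤₚ.≮⇒≥ p↛k) (nonpositive-reverse (ℤₚ.≮⇒≥ q↛k)))
    off-diagonal (yes p→k) (no q↛k)  = changed (*-nonneg-nonneg (ℤₚ.<⇒≤ p→k) (nonpositive-reverse (ℤₚ.≮⇒≥ q↛k)))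
    off-diagonal (no p↛k)  (yes q→k) = changed (*-nonpos-nonpos (ℤₚ.≮⇒≥ p↛k) (ℤₚ.<⇒≤ (arrow-reverse q→k)))

  reflected-companion : IsCompanion reflected (μ k B)
  reflected-companion p q p≢q with p ≟ k | q ≟ k
  ... | yes refl | _        = trans (row-k q) (trans (companion k q p≢q) (sym (ℤₚ.∣-i∣≡∣i∣ (B k q))))
  ... | no p≢k   | yes refl = trans (column-k p) (trans (companion p k p≢q) (sym (ℤₚ.∣-i∣≡∣i∣ (B p k))))
  ... | no p≢k   | no q≢k   = off-diagonal p≢q p≢k q≢k (0ℤ ℤₚ.<? B p k) (0ℤ ℤₚ.<? B q k)

corollary3p3 : ∀ {n : ℕ} (B A : Matrix n) →
    SkewSymmetrizable B →
    AllChordlessCyclesCyclicallyOriented B →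
    PositiveQuasiCartanCompanion A B →
    ∀ (k : Fin n) → ∃[ A′ ] PositiveQuasiCartanCompanion A′ (μ k B)
corollary3p3 B A (dB , dB>0 , skew) oriented ((diagonal , d , d>0 , symmetric , pd) , companion) k =
  reflected , reflected-positiveQuasiCartan d>0 symmetric diagonal k-not-pointsTo-k pd , reflected-companion
  where
  open MutationCompanion {B = B} {A = A} dB>0 skew oriented d>0 symmetric diagonal pd companion k
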